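{- Let $\mathcal U=\{u_1,\dots,u_n\}$ be a set and $\mathcal F=\{F_1,\dots,F_m\}$ a family of subsets of $\mathcal U$ such that every element of $\mathcal U$ lies in some $F_j$, and let $k\le|\mathcal F|$ be a positive integer. Put $\eta=2k+1$ and let $G^{c}$ be the graph with vertex set $\{F_1,\dots,F_m\}\cup\bigcup_{i=1}^{\eta}\{u^i_1,\dots,u^i_n\}\cup\bigcup_{i=1}^{\eta}\{l^i_1,\dots,l^i_n\}\cup\bigcup_{j=1}^m\{L^j_1,L^j_2\}$ (all distinct vertices) and edge set $\bigcup_{j=1}^m\bigcup_{u_i\in F_j}\{u^1_iF_j,\dots,u^{\eta}_iF_j\}\ \cup\ \bigcup_{i=1}^{\eta}\{u^i_1l^i_1,\dots,u^i_nl^i_n\}\ \cup\ \bigcup_{j=1}^m\{F_jL^j_1,F_jL^j_2\}$. Then $(\mathcal U,\mathcal F)$ has a set cover of size $k$ if and only if one can add at most $k$ edges to $G^{c}$ so that the resulting graph is a $DD_2$-graph.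
   Context: All graphs are finite and simple; adding an edge means adding an edge between two nonadjacent vertices. A set cover of size $k$ of $(\mathcal U,\mathcal F)$ is a $k$-element subfamily of $\mathcal F$ whose union is $\mathcal U$. A set $D\subseteq V_G$ is dominating if every vertex of $V_G-D$ has a neighbor in $D$; it is 2-dominating if every vertex of $V_G-D$ has at least two neighbors in $D$. A $DD_2$-pair is a pair $(D,D_2)$ of disjoint vertex sets with $D$ dominating and $D_2$ 2-dominating; a graph is a $DD_2$-graph if it has one. -}

module Defs where

open import Data.Nat using (ℕ; _+_; _*_; _≤_)
open import Data.Fin using (Fin)
open import Data.Fin.Subset using (Subset; _∈_; ∣_∣)
open import Data.Bool using (Bool; true; false)
open import Data.Product using (_×_; _,_; ∃; ∃-syntax; proj₁; proj₂)
open import Data.Sum using (_⊎_)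
open import Data.Empty using (⊥)
open import Data.List using (List; length)
open import Data.List.Relation.Unary.All using (All)
import Data.List.Membership.Propositional as LM
open import Relation.Binary.PropositionalEquality using (_≡_; _≢_)
open import Relation.Nullary using (¬_)

-- Generic graph notions (a graph is given by its adjacency relation on a
-- vertex type V; for the graphs considered here it is symmetric and
-- irreflexive).

Dominating : {V : Set} → (V → V → Set) → (V → Bool) → Set
Dominating {V} Adj D =
  ∀ (v : V) → D v ≡ false → ∃[ w ] (D w ≡ true × Adj v w)

TwoDominating : {V : Set} → (V → V → Set) → (V → Bool) → Set
TwoDominating {V} Adj D₂ =
  ∀ (v : V) → D₂ v ≡ false →
    ∃[ w ] ∃[ w' ] (w ≢ w' × D₂ w ≡ true × D₂ w' ≡ true × Adj v w × Adj v w')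

IsDD2Pair : {V : Set} → (V → V → Set) → (V → Bool) → (V → Bool) → Set
IsDD2Pair {V} Adj D D₂ =
  (∀ (v : V) → ¬ (D v ≡ true × D₂ v ≡ true)) ×
  Dominating Adj D × TwoDominating Adj D₂

IsDD2Graph : {V : Set} → (V → V → Set) → Set
IsDD2Graph {V} Adj = ∃[ D ] ∃[ D₂ ] IsDD2Pair {V} Adj D D₂

addEdges : {V : Set} → (V → V → Set) → List (V × V) → V → V → Set
addEdges Adj E x y = Adj x y ⊎ ((x , y) LM.∈ E ⊎ (y , x) LM.∈ E)

CanAddAtMostToDD2 : {V : Set} → (V → V → Set) → ℕ → Set
CanAddAtMostToDD2 {V} Adj k =
  ∃[ E ] (length E ≤ k ×
          All (λ p → proj₁ p ≢ proj₂ p ×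
                     ¬ Adj (proj₁ p) (proj₂ p)) E ×
          IsDD2Graph (addEdges Adj E))

-- Set cover instance: universe Fin n, family F : Fin m → Subset n
-- (F j ⊆ U automatically).

HasSetCover : {n m : ℕ} → (Fin m → Subset n) → ℕ → Set
HasSetCover {n} {m} F k =
  ∃[ S ] (∣ S ∣ ≡ k × (∀ (u : Fin n) → ∃[ j ] (j ∈ S × u ∈ F j)))

η : ℕ → ℕ
η k = 2 * k + 1

data GcVertex (n m k : ℕ) : Set where
  Fv : Fin m → GcVertex n m k
  uv : Fin (η k) → Fin n → GcVertex n m k
  lv : Fin (η k) → Fin n → GcVertex n m k
  Lv : Fin m → Fin 2 → GcVertex n m k

GcAdj : {n m k : ℕ} → (Fin m → Subset n) →
        GcVertex n m k → GcVertex n m k → Set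
GcAdj F (uv i t) (Fv j)    = t ∈ F j
GcAdj F (Fv j)   (uv i t)  = t ∈ F j
GcAdj F (uv i t) (lv i' t') = i ≡ i' × t ≡ t'
GcAdj F (lv i t) (uv i' t') = i ≡ i' × t ≡ t'
GcAdj F (Fv j)   (Lv j' s) = j ≡ j'
GcAdj F (Lv j s) (Fv j')   = j ≡ j'
GcAdj F _        _         = ⊥

-- Forward: for a cover S, join L^j_1 L^j_2 for every j ∈ S. Then D = all u-vertices,
-- the F_j with j ∉ S and the L^j_1 with j ∈ S, and D₂ = all l-vertices, the F_j with
-- j ∈ S and the remaining leaves, form a DD₂-pair: each u^i_t has the two
-- D₂-neighbours l^i_t and a set vertex F_j ∋ t of the cover.
--
-- Backward: a vertex that no added edge touches and whose only neighbour is u forces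
-- u into D. Let S = {j : F_j ∈ D₂}. For j ∈ S, F_j ∉ D, so both leaves of F_j are
-- touched, whence 2|S| ≤ 2|E| ≤ 2k. The ≤ 2k endpoints miss one of the η = 2k + 1
-- copies, say i; then every u^i_t is forced into D by l^i_t, so it has two
-- D₂-neighbours, one of which is a set vertex containing t. Hence S is a cover with
-- |S| ≤ k, and k ≤ m lets us enlarge it to exactly k sets.

module Submission where

open import Defs
open import Data.Nat using (ℕ; zero; suc; _+_; _*_; _≤_; _<_; z≤n; s≤s; _≤?_)
open import Data.Nat.Properties
  using (≤-trans; ≤-reflexive; ≤-antisym; ≰⇒>; <⇒≱; +-suc; +-comm; +-identityʳ; +-mono-≤; +-monoʳ-≤;
         n<1+n; module ≤-Reasoning;
         *-suc; *-monoʳ-≤; *-cancelˡ-≤; n≤1+n; m≤n⇒m≤1+n)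
open import Data.Fin using (Fin; zero; suc) renaming (_≟_ to _≟ᶠ_)
open import Data.Fin.Properties using (¬∀⟶∃¬)
open import Data.Fin.Subset using (Subset; _∈_; _∪_; _⊆_; ∣_∣; ⊥; ⊤; ⁅_⁆)
open import Data.Fin.Subset.Properties using (x∈⁅x⁆; ∣⁅x⁆∣≡1; x∈p∪q⁺; ∣⊥∣≡0; ∣⊤∣≡n; ∈⊤; p⊆q⇒∣p∣≤∣q∣)
open import Data.Vec using ([]; _∷_; lookup; tabulate; here; there)
open import Data.Vec.Properties using ([]=⇒lookup; lookup⇒[]=; lookup∘tabulate)
open import Data.Bool using (Bool; true; false; not)
open import Data.Bool.Properties using (¬-not)
open import Data.Maybe using (Maybe; just; nothing)
open import Data.Product using (∃-syntax; _×_; _,_; proj₁; proj₂)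
open import Data.Sum using (_⊎_; inj₁; inj₂)
open import Data.List using (List; []; _∷_; length; map; mapMaybe; foldr)
open import Data.List.Properties using (length-map; length-mapMaybe)
open import Data.List.Relation.Unary.All using (universal)
open import Data.List.Relation.Unary.All.Properties using (map⁺)
open import Data.List.Relation.Unary.Any using (here; there)
open import Data.List.Membership.Propositional using () renaming (_∈_ to _∈ₗ_)
open import Data.List.Membership.Propositional.Properties using (∈-map⁺)
import Data.List.Membership.DecPropositional as DecMembership
open import Relation.Binary.PropositionalEquality using (_≡_; refl; sym; trans; cong; subst; _≢_)
open import Relation.Nullary using (¬_; yes; no; contradiction)
open import Function.Bundles using (_⇔_; mk⇔)


∣p∪q∣≤∣p∣+∣q∣ : ∀ {n} (p q : Subset n) → ∣ p ∪ q ∣ ≤ ∣ p ∣ + ∣ q ∣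
∣p∪q∣≤∣p∣+∣q∣ []          []          = z≤n
∣p∪q∣≤∣p∣+∣q∣ (true ∷ p)  (false ∷ q) = s≤s (∣p∪q∣≤∣p∣+∣q∣ p q)
∣p∪q∣≤∣p∣+∣q∣ (true ∷ p)  (true ∷ q)  =
  s≤s (≤-trans (∣p∪q∣≤∣p∣+∣q∣ p q) (+-monoʳ-≤ ∣ p ∣ (n≤1+n ∣ q ∣)))
∣p∪q∣≤∣p∣+∣q∣ (false ∷ p) (true ∷ q)  =
  ≤-trans (s≤s (∣p∪q∣≤∣p∣+∣q∣ p q)) (≤-reflexive (sym (+-suc ∣ p ∣ ∣ q ∣)))
∣p∪q∣≤∣p∣+∣q∣ (false ∷ p) (false ∷ q) = ∣p∪q∣≤∣p∣+∣q∣ p q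

module _ {p : ℕ} where

  open DecMembership (_≟ᶠ_ {p}) using () renaming (_∈?_ to _∈ₗ?_)

  fromList : List (Fin p) → Subset p
  fromList = foldr (λ x s → ⁅ x ⁆ ∪ s) ⊥

  ∈-fromList⁺ : ∀ {x} {xs : List (Fin p)} → x ∈ₗ xs → x ∈ fromList xs
  ∈-fromList⁺ {x} (here refl) = x∈p∪q⁺ (inj₁ (x∈⁅x⁆ x))
  ∈-fromList⁺ (there x∈xs)    = x∈p∪q⁺ (inj₂ (∈-fromList⁺ x∈xs))

  ∣fromList∣≤length : (xs : List (Fin p)) → ∣ fromList xs ∣ ≤ length xs
  ∣fromList∣≤length []       = ≤-reflexive (∣⊥∣≡0 p)
  ∣fromList∣≤length (x ∷ xs) = ≤-trans (∣p∪q∣≤∣p∣+∣q∣ ⁅ x ⁆ (fromList xs))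
    (≤-trans (≤-reflexive (cong (_+ ∣ fromList xs ∣) (∣⁅x⁆∣≡1 x))) (s≤s (∣fromList∣≤length xs)))

  ∣S∣≤length : (S : Subset p) (xs : List (Fin p)) → (∀ {x} → x ∈ S → x ∈ₗ xs) → ∣ S ∣ ≤ length xs
  ∣S∣≤length S xs S⊆xs = ≤-trans (p⊆q⇒∣p∣≤∣q∣ (λ x∈S → ∈-fromList⁺ (S⊆xs x∈S))) (∣fromList∣≤length xs)

  length<n⇒∃∉ : (xs : List (Fin p)) → length xs < p → ∃[ i ] ¬ (i ∈ₗ xs)
  length<n⇒∃∉ xs xs<p = ¬∀⟶∃¬ p (_∈ₗ xs) (_∈ₗ? xs) λ all∈ →
    <⇒≱ xs<p (subst (_≤ length xs) (∣⊤∣≡n p) (∣S∣≤length ⊤ xs (λ {x} _ → all∈ x)))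

elements : ∀ {p} → Subset p → List (Fin p)
elements []          = []
elements (true ∷ s)  = zero ∷ map suc (elements s)
elements (false ∷ s) = map suc (elements s)

length-elements : ∀ {p} (s : Subset p) → length (elements s) ≡ ∣ s ∣
length-elements []          = refl
length-elements (true ∷ s)  = cong suc (trans (length-map suc (elements s)) (length-elements s))
length-elements (false ∷ s) = trans (length-map suc (elements s)) (length-elements s)

∈-elements⁺ : ∀ {p} {x : Fin p} (s : Subset p) → x ∈ s → x ∈ₗ elements s
∈-elements⁺ (true ∷ s)  here         = here refl
∈-elements⁺ (true ∷ s)  (there x∈s)  = there (∈-map⁺ suc (∈-elements⁺ s x∈s))
∈-elements⁺ (false ∷ s) (there x∈s)  = ∈-map⁺ suc (∈-elements⁺ s x∈s)

⊆-extendTo : ∀ {p} (S : Subset p) (k : ℕ) → ∣ S ∣ ≤ k → k ≤ p → ∃[ T ] (∣ T ∣ ≡ k × S ⊆ T)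
⊆-extendTo [] zero _ _ = [] , refl , λ x∈S → x∈S
⊆-extendTo (true ∷ S) (suc k) (s≤s ∣S∣≤k) (s≤s k≤p) with ⊆-extendTo S k ∣S∣≤k k≤p
... | T , ∣T∣≡k , S⊆T = true ∷ T , cong suc ∣T∣≡k , λ { here → here ; (there x∈S) → there (S⊆T x∈S) }
⊆-extendTo {suc p} (false ∷ S) k ∣S∣≤k k≤1+p with k ≤? p
... | yes k≤p with ⊆-extendTo S k ∣S∣≤k k≤p
...   | T , ∣T∣≡k , S⊆T = false ∷ T , ∣T∣≡k , λ { (there x∈S) → there (S⊆T x∈S) }
⊆-extendTo {suc p} (false ∷ S) k _ k≤1+p | no k≰p =
  ⊤ , trans (∣⊤∣≡n (suc p)) (≤-antisym (≰⇒> k≰p) k≤1+p) , λ _ → ∈⊤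


module _ {A B : Set} where

  ∈-mapMaybe⁺ : ∀ {f : A → Maybe B} {x y} (xs : List A) → x ∈ₗ xs → f x ≡ just y → y ∈ₗ mapMaybe f xs
  ∈-mapMaybe⁺ (x ∷ xs) (here refl) fx≡just rewrite fx≡just = here refl
  ∈-mapMaybe⁺ {f} (x ∷ xs) (there x∈xs) fx≡just with f x
  ... | just _  = there (∈-mapMaybe⁺ xs x∈xs fx≡just)
  ... | nothing = ∈-mapMaybe⁺ xs x∈xs fx≡just

  length-mapMaybe-disjoint : (f g : A → Maybe B) → (∀ x → f x ≡ nothing ⊎ g x ≡ nothing) →
    (xs : List A) → length (mapMaybe f xs) + length (mapMaybe g xs) ≤ length xs
  length-mapMaybe-disjoint f g disjoint [] = z≤n
  length-mapMaybe-disjoint f g disjoint (x ∷ xs) with f x | g x | disjoint x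
  ... | nothing | nothing | _       = m≤n⇒m≤1+n (length-mapMaybe-disjoint f g disjoint xs)
  ... | just _  | nothing | _       = s≤s (length-mapMaybe-disjoint f g disjoint xs)
  ... | nothing | just _  | _       = ≤-trans
    (≤-reflexive (+-suc (length (mapMaybe f xs)) (length (mapMaybe g xs))))
    (s≤s (length-mapMaybe-disjoint f g disjoint xs))
  ... | just _  | just _  | inj₁ ()
  ... | just _  | just _  | inj₂ ()


module _ {V : Set} where

  endpoints : List (V × V) → List V
  endpoints []            = []
  endpoints ((x , y) ∷ E) = x ∷ y ∷ endpoints E

  length-endpoints : (E : List (V × V)) → length (endpoints E) ≡ 2 * length E
  length-endpoints []      = refl
  length-endpoints (_ ∷ E) =
    trans (cong (λ l → suc (suc l)) (length-endpoints E)) (sym (*-suc 2 (length E)))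

  addEdges-untouched : (Adj : V → V → Set) (E : List (V × V)) {v w : V} →
    ¬ (v ∈ₗ endpoints E) → addEdges Adj E v w → Adj v w
  addEdges-untouched Adj E v∉E (inj₁ vw)       = vw
  addEdges-untouched Adj E v∉E (inj₂ (inj₁ e)) = contradiction (first E e) v∉E
    where
      first : ∀ {x y} E → (x , y) ∈ₗ E → x ∈ₗ endpoints E
      first (_ ∷ E) (here refl) = here refl
      first (_ ∷ E) (there e)   = there (there (first E e))
  addEdges-untouched Adj E v∉E (inj₂ (inj₂ e)) = contradiction (second E e) v∉E
    where
      second : ∀ {x y} E → (x , y) ∈ₗ E → y ∈ₗ endpoints E
      second (_ ∷ E) (here refl) = there (here refl)
      second (_ ∷ E) (there e)   = there (there (second E e))

  -- A vertex with a single neighbour u cannot have two neighbours in D₂, so it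
  -- lies in D₂, hence outside D, and must be dominated by u.
  DD2Pair-leaf : {Adj : V → V → Set} {D D₂ : V → Bool} → IsDD2Pair Adj D D₂ →
    {v u : V} → (∀ w → Adj v w → w ≡ u) → D u ≡ true
  DD2Pair-leaf {D₂ = D₂} (_ , _ , twoDominating) {v} onlyU with D₂ v in D₂v
  ... | false with twoDominating v D₂v
  ...   | w , w' , w≢w' , _ , _ , vw , vw' = contradiction (trans (onlyU w vw) (sym (onlyU w' vw'))) w≢w'
  DD2Pair-leaf {D = D} (disjoint , dominating , _) {v} onlyU | true
    with dominating v (¬-not λ v∈D → disjoint v (v∈D , D₂v))
  ... | w , w∈D , vw = subst (λ x → D x ≡ true) (onlyU w vw) w∈D


module _ {n m k : ℕ} (F : Fin m → Subset n) where

  private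
    V   = GcVertex n m k
    Adj = GcAdj {n} {m} {k} F

  leafEdge : Fin m → V × V
  leafEdge j = Lv j zero , Lv j (suc zero)

  module _ (S : Subset m) where

    leafEdges : List (V × V)
    leafEdges = map leafEdge (elements S)

    private
      G = addEdges Adj leafEdges

    leafEdge∈leafEdges : ∀ {j} → lookup S j ≡ true → leafEdge j ∈ₗ leafEdges
    leafEdge∈leafEdges {j} j∈S = ∈-map⁺ leafEdge (∈-elements⁺ S (lookup⇒[]= j S j∈S))

    D D₂ : V → Bool
    D (Fv j)             = not (lookup S j)
    D (uv _ _)           = true
    D (lv _ _)           = false
    D (Lv j zero)        = lookup S j
    D (Lv _ (suc zero))  = false
    D₂ (Fv j)            = lookup S j
    D₂ (uv _ _)          = false
    D₂ (lv _ _)          = true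
    D₂ (Lv j zero)       = not (lookup S j)
    D₂ (Lv _ (suc zero)) = true

    D-D₂-disjoint : ∀ v → ¬ (D v ≡ true × D₂ v ≡ true)
    D-D₂-disjoint (Fv j) with lookup S j
    ... | true  = λ { (() , _) }
    ... | false = λ { (_ , ()) }
    D-D₂-disjoint (uv _ _) (_ , ())
    D-D₂-disjoint (lv _ _) (() , _)
    D-D₂-disjoint (Lv j zero) with lookup S j
    ... | true  = λ { (_ , ()) }
    ... | false = λ { (() , _) }
    D-D₂-disjoint (Lv _ (suc zero)) (() , _)

    D-dominating : Dominating G D
    D-dominating (Fv j) v∉D with lookup S j in j∈?S
    ... | true = Lv j zero , j∈?S , inj₁ refl
    D-dominating (uv _ _) ()
    D-dominating (lv i t) _ = uv i t , refl , inj₁ (refl , refl)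
    D-dominating (Lv j zero) v∉D = Fv j , cong not v∉D , inj₁ refl
    D-dominating (Lv j (suc zero)) _ with lookup S j in j∈?S
    ... | true  = Lv j zero , j∈?S , inj₂ (inj₂ (leafEdge∈leafEdges j∈?S))
    ... | false = Fv j , cong not j∈?S , inj₁ refl

    D₂-twoDominating : (∀ (u : Fin n) → ∃[ j ] (j ∈ S × u ∈ F j)) → TwoDominating G D₂
    D₂-twoDominating _ (Fv j) v∉D₂ =
      Lv j zero , Lv j (suc zero) , (λ ()) , cong not v∉D₂ , refl , inj₁ refl , inj₁ refl
    D₂-twoDominating covers (uv i t) _ with covers t
    ... | j , j∈S , t∈Fj = Fv j , lv i t , (λ ()) , []=⇒lookup j∈S , refl , inj₁ t∈Fj , inj₁ (refl , refl)
    D₂-twoDominating _ (lv _ _) ()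
    D₂-twoDominating _ (Lv j zero) v∉D₂ with lookup S j in j∈?S
    ... | true = Fv j , Lv j (suc zero) , (λ ()) , j∈?S , refl , inj₁ refl , inj₂ (inj₁ (leafEdge∈leafEdges j∈?S))
    D₂-twoDominating _ (Lv _ (suc zero)) ()

    leafEdges-isDD2Graph : (∀ (u : Fin n) → ∃[ j ] (j ∈ S × u ∈ F j)) → IsDD2Graph G
    leafEdges-isDD2Graph covers = D , D₂ , D-D₂-disjoint , D-dominating , D₂-twoDominating covers

  setCover⇒canAddToDD2 : HasSetCover F k → CanAddAtMostToDD2 Adj k
  setCover⇒canAddToDD2 (S , ∣S∣≡k , covers) =
    leafEdges S ,
    ≤-reflexive (trans (length-map leafEdge (elements S)) (trans (length-elements S) ∣S∣≡k)) ,
    map⁺ (universal (λ _ → (λ ()) , (λ ())) (elements S)) ,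
    leafEdges-isDD2Graph S covers

  lv-neighbour : ∀ {i t} w → Adj (lv i t) w → w ≡ uv i t
  lv-neighbour (uv _ _) (refl , refl) = refl

  Lv-neighbour : ∀ {j s} w → Adj (Lv j s) w → w ≡ Fv j
  Lv-neighbour (Fv _) refl = refl

  -- The only neighbour of u^i_t that is not a set vertex is l^i_t.
  uv-setNeighbour : ∀ {i t w w'} (P : V → Set) → w ≢ w' → P w → P w' →
    Adj (uv i t) w → Adj (uv i t) w' → ∃[ j ] (P (Fv j) × t ∈ F j)
  uv-setNeighbour {w = Fv j}   _ _ Pw _ t∈Fj _ = j , Pw , t∈Fj
  uv-setNeighbour {w = lv _ _} {Fv j} _ _ _ Pw' _ t∈Fj = j , Pw' , t∈Fj
  uv-setNeighbour {w = lv _ _} {lv _ _} _ w≢w' _ _ (refl , refl) (refl , refl) = contradiction refl w≢w'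

  leafIndex : Fin 2 → V → Maybe (Fin m)
  leafIndex zero       (Lv j zero)       = just j
  leafIndex (suc zero) (Lv j (suc zero)) = just j
  leafIndex _          _                 = nothing

  leafIndex-Lv : ∀ s j → leafIndex s (Lv j s) ≡ just j
  leafIndex-Lv zero       j = refl
  leafIndex-Lv (suc zero) j = refl

  leafIndex-disjoint : ∀ v → leafIndex zero v ≡ nothing ⊎ leafIndex (suc zero) v ≡ nothing
  leafIndex-disjoint (Lv _ zero)       = inj₂ refl
  leafIndex-disjoint (Lv _ (suc zero)) = inj₁ refl
  leafIndex-disjoint (Fv _)            = inj₁ refl
  leafIndex-disjoint (uv _ _)          = inj₁ refl
  leafIndex-disjoint (lv _ _)          = inj₁ refl

  copyIndex : V → Maybe (Fin (η k))
  copyIndex (uv i _) = just i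
  copyIndex (lv i _) = just i
  copyIndex _        = nothing

  module _ (E : List (V × V)) (E≤k : length E ≤ k) (D D₂ : V → Bool)
           (pair : IsDD2Pair (addEdges Adj E) D D₂) where

    open DecMembership (_≟ᶠ_ {m}) using () renaming (_∈?_ to _∈ₗ?_)

    private
      disjoint = proj₁ pair
      twoDominating = proj₂ (proj₂ pair)

    untouchedLeaf : ∀ {v u} → ¬ (v ∈ₗ endpoints E) → (∀ w → Adj v w → w ≡ u) → D u ≡ true
    untouchedLeaf v∉E onlyU = DD2Pair-leaf pair λ w vw → onlyU w (addEdges-untouched Adj E v∉E vw)

    chosen : Subset m
    chosen = tabulate (λ j → D₂ (Fv j))

    ∈-chosen⁺ : ∀ {j} → D₂ (Fv j) ≡ true → j ∈ chosen
    ∈-chosen⁺ {j} Fj∈D₂ = lookup⇒[]= j chosen (trans (lookup∘tabulate _ j) Fj∈D₂)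

    ∈-chosen⁻ : ∀ {j} → j ∈ chosen → D₂ (Fv j) ≡ true
    ∈-chosen⁻ {j} j∈S = trans (sym (lookup∘tabulate (λ j → D₂ (Fv j)) j)) ([]=⇒lookup j∈S)

    chosen-leafTouched : ∀ s {j} → j ∈ chosen → j ∈ₗ mapMaybe (leafIndex s) (endpoints E)
    chosen-leafTouched s {j} j∈S with j ∈ₗ? mapMaybe (leafIndex s) (endpoints E)
    ... | yes listed  = listed
    ... | no unlisted = contradiction
      (untouchedLeaf (λ leaf∈E → unlisted (∈-mapMaybe⁺ _ leaf∈E (leafIndex-Lv s j))) Lv-neighbour ,
       ∈-chosen⁻ j∈S)
      (disjoint (Fv j))

    ∣chosen∣≤k : ∣ chosen ∣ ≤ k
    ∣chosen∣≤k = *-cancelˡ-≤ 2 (begin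
      2 * ∣ chosen ∣
        ≡⟨ cong (∣ chosen ∣ +_) (+-identityʳ ∣ chosen ∣) ⟩
      ∣ chosen ∣ + ∣ chosen ∣
        ≤⟨ +-mono-≤ (leaves zero) (leaves (suc zero)) ⟩
      length (mapMaybe (leafIndex zero) (endpoints E)) + length (mapMaybe (leafIndex (suc zero)) (endpoints E))
        ≤⟨ length-mapMaybe-disjoint _ _ leafIndex-disjoint (endpoints E) ⟩
      length (endpoints E)
        ≡⟨ length-endpoints E ⟩
      2 * length E
        ≤⟨ *-monoʳ-≤ 2 E≤k ⟩
      2 * k ∎)
      where
        open ≤-Reasoning
        leaves : ∀ s → ∣ chosen ∣ ≤ length (mapMaybe (leafIndex s) (endpoints E))
        leaves s = ∣S∣≤length chosen _ (chosen-leafTouched s)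

    ∣copies∣<η : length (mapMaybe copyIndex (endpoints E)) < η k
    ∣copies∣<η = begin-strict
      length (mapMaybe copyIndex (endpoints E)) ≤⟨ length-mapMaybe copyIndex (endpoints E) ⟩
      length (endpoints E)                      ≡⟨ length-endpoints E ⟩
      2 * length E                              ≤⟨ *-monoʳ-≤ 2 E≤k ⟩
      2 * k                                     <⟨ n<1+n (2 * k) ⟩
      suc (2 * k)                               ≡⟨ +-comm 1 (2 * k) ⟩
      η k                                       ∎
      where open ≤-Reasoning

    untouchedCopy : ∃[ i ] (∀ t → ¬ (uv i t ∈ₗ endpoints E) × ¬ (lv i t ∈ₗ endpoints E))
    untouchedCopy with length<n⇒∃∉ (mapMaybe copyIndex (endpoints E)) ∣copies∣<η
    ... | i , unlisted = i , λ t →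
      (λ uv∈E → unlisted (∈-mapMaybe⁺ _ uv∈E refl)) , (λ lv∈E → unlisted (∈-mapMaybe⁺ _ lv∈E refl))

    uv∉D₂ : ∀ {i t} → ¬ (lv i t ∈ₗ endpoints E) → D₂ (uv i t) ≡ false
    uv∉D₂ {i} {t} lv∉E =
      ¬-not λ uv∈D₂ → disjoint (uv i t) (untouchedLeaf lv∉E lv-neighbour , uv∈D₂)

    chosen-covers : ∀ (t : Fin n) → ∃[ j ] (j ∈ chosen × t ∈ F j)
    chosen-covers t with untouchedCopy
    ... | i , untouched with untouched t
    ...   | uv∉E , lv∉E with twoDominating (uv i t) (uv∉D₂ lv∉E)
    ...     | w , w' , w≢w' , w∈D₂ , w'∈D₂ , uw , uw'
      with uv-setNeighbour (λ x → D₂ x ≡ true) w≢w' w∈D₂ w'∈D₂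
             (addEdges-untouched Adj E uv∉E uw) (addEdges-untouched Adj E uv∉E uw')
    ... | j , Fj∈D₂ , t∈Fj = j , ∈-chosen⁺ Fj∈D₂ , t∈Fj

  canAddToDD2⇒setCover : k ≤ m → CanAddAtMostToDD2 Adj k → HasSetCover F k
  canAddToDD2⇒setCover k≤m (E , E≤k , _ , D , D₂ , pair)
    with ⊆-extendTo (chosen E E≤k D D₂ pair) k (∣chosen∣≤k E E≤k D D₂ pair) k≤m
  ... | T , ∣T∣≡k , chosen⊆T = T , ∣T∣≡k , λ t →
    let j , j∈chosen , t∈Fj = chosen-covers E E≤k D D₂ pair t in j , chosen⊆T j∈chosen , t∈Fj

mainTheorem9 : (n m k : ℕ) (F : Fin m → Subset n) →
    (∀ (j j' : Fin m) → F j ≡ F j' → j ≡ j') →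
    (∀ (u : Fin n) → ∃[ j ] (u ∈ F j)) →
    1 ≤ k → k ≤ m →
    HasSetCover F k ⇔ CanAddAtMostToDD2 (GcAdj {n} {m} {k} F) k
mainTheorem9 n m k F _ _ _ k≤m = mk⇔ (setCover⇒canAddToDD2 F) (canAddToDD2⇒setCover F k≤m)
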